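{- For every $n \in \mathbb{N}$ and every $T \in \{0,1,\ldots,n\}$, there is a polynomial $P_T(x_1,\ldots,x_n)$ with integer coefficients of degree at most $3\sqrt{n}$ such that for all $a \in \{0,1\}^n$, $P_T(a) \equiv 0 \pmod 6$ if and only if $\sum_i a_i = T$. -}

module Defs where

open import Data.Nat using (ℕ; _+_; _*_; _≤_)
open import Data.Integer as ℤ using (ℤ; _^_)
open import Data.Bool using (Bool; true; false)
open import Data.Product using (_×_; _,_)
open import Data.List using (List; []; _∷_)
open import Data.List.Relation.Unary.All using (All)
open import Data.Vec using (Vec; zipWith; map)
import Data.Vec as Vec

-- A monomial c · x₁^e₁ ⋯ xₙ^eₙ with integer coefficient c and exponent vector e.
Monomial : ℕ → Set
Monomial n = ℤ × Vec ℕ n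

-- A polynomial in n variables with integer coefficients: a finite sum of monomials.
Poly : ℕ → Set
Poly n = List (Monomial n)

monoDeg : ∀ {n} → Monomial n → ℕ
monoDeg (_ , e) = Vec.sum e

DegreeAtMost : ∀ {n} → ℕ → Poly n → Set
DegreeAtMost d P = All (λ m → monoDeg m ≤ d) P

evalMono : ∀ {n} → Vec ℤ n → Monomial n → ℤ
evalMono x (c , e) = c ℤ.* Vec.foldr _ ℤ._*_ (ℤ.+ 1) (zipWith _^_ x e)

eval : ∀ {n} → Poly n → Vec ℤ n → ℤ
eval [] x = ℤ.+ 0
eval (m ∷ P) x = evalMono x m ℤ.+ eval P x

bitℤ : Bool → ℤ
bitℤ true = ℤ.+ 1
bitℤ false = ℤ.+ 0

bitℕ : Bool → ℕ
bitℕ true = 1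
bitℕ false = 0

weight : ∀ {n} → Vec Bool n → ℕ
weight a = Vec.sum (map bitℕ a)

-- Let w be the Hamming weight of a ∈ {0,1}ⁿ. The k-th elementary symmetric polynomial, of degree k, takes
-- the value C(w, k) at a, and for a prime p Lucas' theorem gives C(w, pʲ) ≡ ⌊w / pʲ⌋ (mod p), the j-th
-- base-p digit of w. A polynomial of degree p - 1 in C(w, pʲ) that is 1 or 0 modulo p according as this
-- digit agrees with that of T, multiplied over j < s, gives M_p of degree pˢ - 1 with M_p ≡ 1 (mod p) if
-- w ≡ T (mod pˢ) and M_p ≡ 0 otherwise. Then 3(1 + M₂) + 2(2 + M₃) is divisible by 6 exactly when w agrees
-- with T modulo 2ˢ and 3ᵗ, which by the Chinese remainder theorem means w = T once w, T ≤ n < 2ˢ3ᵗ.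
-- Choosing 4ˢ ∈ (n, 4n + 1] and 9ᵗ ∈ (n, 9n + 1] keeps the degree max(2ˢ, 3ᵗ) - 1 at most 3√n.

module Submission where

open import Defs
import Algebra.Properties.CommutativeSemigroup as CSProps
open import Data.Bool using (Bool; true; false)
open import Data.Integer as ℤ using (ℤ; +_)
import Data.Integer.Divisibility as ℤ
import Data.Integer.Properties as ℤP
open import Data.List as List using ([]; _∷_; _++_)
open import Data.List.Relation.Unary.All as All using ([]; _∷_)
open import Data.List.Relation.Unary.All.Properties using (++⁺; map⁺)
open import Data.Nat
open import Data.Nat.Combinatorics using (_C_; nCk+nC[k+1]≡[n+1]C[k+1]; nCn≡1; nC1≡n; k>n⇒nCk≡0)
open import Data.Nat.DivMod
open import Data.Nat.Divisibility
open import Data.Nat.Primality using (Prime; prime[2]; prime?; prime⇒nonZero; prime⇒nonTrivial; euclidsLemma)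
open import Data.Nat.Properties
open import Data.Nat.Tactic.RingSolver using (solve-∀)
open import Data.Product using (Σ; ∃-syntax; _×_; _,_; proj₁; proj₂; map₂)
open import Data.Product.Function.NonDependent.Propositional using (_×-⇔_)
open import Data.Sum using (_⊎_; inj₁; inj₂)
open import Data.Vec as Vec using (Vec; []; _∷_; map; replicate; zipWith)
open import Function using (_∘_)
open import Function.Bundles using (_⇔_; mk⇔; Equivalence)
open import Function.Construct.Composition using (_⇔-∘_)
import Function.Construct.Identity as Identity
open import Function.Construct.Symmetry using (⇔-sym)
open import Function.Properties.Equivalence using (⇔-setoid)
open import Level using (0ℓ)
import Relation.Binary.Reasoning.Setoid as SetoidReasoning
open import Relation.Binary.PropositionalEquality
open import Relation.Nullary using (¬_; yes; no)
open import Relation.Nullary.Decidable using (from-yes)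
open import Relation.Nullary.Negation using (contradiction)

private
  variable
    n d e : ℕ
    P Q : Poly n
    f g : ℕ → ℕ
    X Y : Set

-- Polynomial arithmetic

powerProduct : Vec ℤ n → Vec ℕ n → ℤ
powerProduct x e = Vec.foldr _ ℤ._*_ (+ 1) (zipWith ℤ._^_ x e)

powerProduct-zeros : (x : Vec ℤ n) → powerProduct x (replicate n 0) ≡ + 1
powerProduct-zeros [] = refl
powerProduct-zeros (_ ∷ x) = trans (ℤP.*-identityˡ _) (powerProduct-zeros x)

powerProduct-+ : (x : Vec ℤ n) (e f : Vec ℕ n) →
  powerProduct x (zipWith _+_ e f) ≡ powerProduct x e ℤ.* powerProduct x f
powerProduct-+ [] [] [] = refl
powerProduct-+ (y ∷ x) (i ∷ e) (j ∷ f) = begin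
  y ℤ.^ (i + j) ℤ.* powerProduct x (zipWith _+_ e f)
    ≡⟨ cong₂ ℤ._*_ (ℤP.^-distribˡ-+-* y i j) (powerProduct-+ x e f) ⟩
  (y ℤ.^ i ℤ.* y ℤ.^ j) ℤ.* (powerProduct x e ℤ.* powerProduct x f)
    ≡⟨ CSProps.interchange ℤP.*-commutativeSemigroup
         (y ℤ.^ i) (y ℤ.^ j) (powerProduct x e) (powerProduct x f) ⟩
  (y ℤ.^ i ℤ.* powerProduct x e) ℤ.* (y ℤ.^ j ℤ.* powerProduct x f) ∎
  where open ≡-Reasoning

sum-zipWith-+ : (e f : Vec ℕ n) → Vec.sum (zipWith _+_ e f) ≡ Vec.sum e + Vec.sum f
sum-zipWith-+ [] [] = refl
sum-zipWith-+ (i ∷ e) (j ∷ f) =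
  trans (cong (λ s → i + j + s) (sum-zipWith-+ e f)) (CSProps.interchange +-commutativeSemigroup i j _ _)

sum-replicate-0 : ∀ n → Vec.sum (replicate n 0) ≡ 0
sum-replicate-0 zero = refl
sum-replicate-0 (suc n) = sum-replicate-0 n

constant : ℤ → Poly n
constant c = (c , replicate _ 0) ∷ []

_*ᴹ_ : Monomial n → Monomial n → Monomial n
(c , e) *ᴹ (c' , e') = c ℤ.* c' , zipWith _+_ e e'

infixl 7 _*ᴾ_
_*ᴾ_ : Poly n → Poly n → Poly n
[] *ᴾ Q = []
(m ∷ P) *ᴾ Q = List.map (m *ᴹ_) Q ++ P *ᴾ Q

-- x₀ is the new first variable.
extend : Poly n → Poly (suc n)
extend = List.map (map₂ (0 ∷_))

x₀*_ : Poly n → Poly (suc n)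
x₀* P = List.map (map₂ (1 ∷_)) P

module _ (x : Vec ℤ n) where
  eval-constant : ∀ c → eval (constant c) x ≡ c
  eval-constant c = begin
    c ℤ.* powerProduct x (replicate _ 0) ℤ.+ + 0 ≡⟨ ℤP.+-identityʳ _ ⟩
    c ℤ.* powerProduct x (replicate _ 0)       ≡⟨ cong (c ℤ.*_) (powerProduct-zeros x) ⟩
    c ℤ.* + 1                                   ≡⟨ ℤP.*-identityʳ c ⟩
    c                                           ∎
    where open ≡-Reasoning

  eval-++ : (P Q : Poly n) → eval (P ++ Q) x ≡ eval P x ℤ.+ eval Q x
  eval-++ [] Q = sym (ℤP.+-identityˡ _)
  eval-++ (m ∷ P) Q =
    trans (cong (λ z → evalMono x m ℤ.+ z) (eval-++ P Q)) (sym (ℤP.+-assoc (evalMono x m) _ _))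

  evalMono-*ᴹ : (m m' : Monomial n) → evalMono x (m *ᴹ m') ≡ evalMono x m ℤ.* evalMono x m'
  evalMono-*ᴹ (c , e) (c' , e') =
    trans (cong (c ℤ.* c' ℤ.*_) (powerProduct-+ x e e'))
          (CSProps.interchange ℤP.*-commutativeSemigroup c c' _ _)

  eval-map-*ᴹ : (m : Monomial n) (Q : Poly n) → eval (List.map (m *ᴹ_) Q) x ≡ evalMono x m ℤ.* eval Q x
  eval-map-*ᴹ m [] = sym (ℤP.*-zeroʳ (evalMono x m))
  eval-map-*ᴹ m (m' ∷ Q) =
    trans (cong₂ ℤ._+_ (evalMono-*ᴹ m m') (eval-map-*ᴹ m Q)) (sym (ℤP.*-distribˡ-+ (evalMono x m) _ _))

  eval-*ᴾ : (P Q : Poly n) → eval (P *ᴾ Q) x ≡ eval P x ℤ.* eval Q x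
  eval-*ᴾ [] Q = sym (ℤP.*-zeroˡ (eval Q x))
  eval-*ᴾ (m ∷ P) Q = begin
    eval (List.map (m *ᴹ_) Q ++ P *ᴾ Q) x
      ≡⟨ eval-++ (List.map (m *ᴹ_) Q) (P *ᴾ Q) ⟩
    eval (List.map (m *ᴹ_) Q) x ℤ.+ eval (P *ᴾ Q) x
      ≡⟨ cong₂ ℤ._+_ (eval-map-*ᴹ m Q) (eval-*ᴾ P Q) ⟩
    evalMono x m ℤ.* eval Q x ℤ.+ eval P x ℤ.* eval Q x
      ≡⟨ ℤP.*-distribʳ-+ (eval Q x) (evalMono x m) (eval P x) ⟨
    (evalMono x m ℤ.+ eval P x) ℤ.* eval Q x ∎
    where open ≡-Reasoning

  eval-extend : ∀ y (P : Poly n) → eval (extend P) (y ∷ x) ≡ eval P x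
  eval-extend y [] = refl
  eval-extend y ((c , e) ∷ P) = cong₂ ℤ._+_ (cong (c ℤ.*_) (ℤP.*-identityˡ _)) (eval-extend y P)

  eval-x₀* : ∀ y (P : Poly n) → eval (x₀* P) (y ∷ x) ≡ y ℤ.* eval P x
  eval-x₀* y [] = sym (ℤP.*-zeroʳ y)
  eval-x₀* y ((c , e) ∷ P) = begin
    c ℤ.* (y ℤ.^ 1 ℤ.* powerProduct x e) ℤ.+ eval (x₀* P) (y ∷ x)
      ≡⟨ cong₂ ℤ._+_ (cong (λ z → c ℤ.* (z ℤ.* _)) (ℤP.*-identityʳ y)) (eval-x₀* y P) ⟩
    c ℤ.* (y ℤ.* powerProduct x e) ℤ.+ y ℤ.* eval P x
      ≡⟨ cong (ℤ._+ _) (CSProps.x∙yz≈y∙xz ℤP.*-commutativeSemigroup c y _) ⟩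
    y ℤ.* (c ℤ.* powerProduct x e) ℤ.+ y ℤ.* eval P x
      ≡⟨ ℤP.*-distribˡ-+ y _ _ ⟨
    y ℤ.* eval ((c , e) ∷ P) x ∎
    where open ≡-Reasoning

constant-degree : ∀ c → DegreeAtMost 0 (constant {n} c)
constant-degree {n} c = ≤-reflexive (sum-replicate-0 n) ∷ []

degree-weaken : d ≤ e → DegreeAtMost d P → DegreeAtMost e P
degree-weaken d≤e = All.map (λ m≤d → ≤-trans m≤d d≤e)

*ᴹ-degree : (m m' : Monomial n) → monoDeg (m *ᴹ m') ≡ monoDeg m + monoDeg m'
*ᴹ-degree (_ , e) (_ , e') = sum-zipWith-+ e e'

*ᴾ-degree : DegreeAtMost d P → DegreeAtMost e Q → DegreeAtMost (d + e) (P *ᴾ Q)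
*ᴾ-degree [] Q≤e = []
*ᴾ-degree {P = m ∷ _} (m≤d ∷ P≤d) Q≤e =
  ++⁺ (map⁺ (All.map (λ {m'} m'≤e → ≤-trans (≤-reflexive (*ᴹ-degree m m')) (+-mono-≤ m≤d m'≤e)) Q≤e))
      (*ᴾ-degree P≤d Q≤e)

extend-degree : DegreeAtMost d P → DegreeAtMost d (extend P)
extend-degree = map⁺

x₀*-degree : DegreeAtMost d P → DegreeAtMost (suc d) (x₀* P)
x₀*-degree P≤d = map⁺ (All.map s≤s P≤d)

elementary : (n k : ℕ) → Poly n
elementary n zero = constant (+ 1)
elementary zero (suc k) = []
elementary (suc n) (suc k) = extend (elementary n (suc k)) ++ x₀* elementary n k

elementary-degree : ∀ n k → DegreeAtMost k (elementary n k)
elementary-degree n zero = constant-degree (+ 1)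
elementary-degree zero (suc k) = []
elementary-degree (suc n) (suc k) =
  ++⁺ (extend-degree (elementary-degree n (suc k))) (x₀*-degree (elementary-degree n k))

pascal-bit : ∀ b w k → + (w C suc k) ℤ.+ bitℤ b ℤ.* + (w C k) ≡ + ((bitℕ b + w) C suc k)
pascal-bit true w k =
  trans (cong (λ z → + (w C suc k) ℤ.+ z) (ℤP.*-identityˡ (+ (w C k))))
        (cong +_ (trans (+-comm (w C suc k) (w C k)) (nCk+nC[k+1]≡[n+1]C[k+1] w k)))
pascal-bit false w k = ℤP.+-identityʳ _

eval-elementary : ∀ n k (a : Vec Bool n) → eval (elementary n k) (map bitℤ a) ≡ + (weight a C k)
eval-elementary n zero a = eval-constant (map bitℤ a) (+ 1)
eval-elementary zero (suc k) [] = refl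
eval-elementary (suc n) (suc k) (b ∷ a) = begin
  eval (extend (elementary n (suc k)) ++ x₀* elementary n k) (bitℤ b ∷ x)
    ≡⟨ eval-++ (bitℤ b ∷ x) (extend (elementary n (suc k))) (x₀* elementary n k) ⟩
  eval (extend (elementary n (suc k))) (bitℤ b ∷ x) ℤ.+ eval (x₀* elementary n k) (bitℤ b ∷ x)
    ≡⟨ cong₂ ℤ._+_ (eval-extend x (bitℤ b) (elementary n (suc k))) (eval-x₀* x (bitℤ b) (elementary n k)) ⟩
  eval (elementary n (suc k)) x ℤ.+ bitℤ b ℤ.* eval (elementary n k) x
    ≡⟨ cong₂ (λ u v → u ℤ.+ bitℤ b ℤ.* v) (eval-elementary n (suc k) a) (eval-elementary n k a) ⟩
  + (weight a C suc k) ℤ.+ bitℤ b ℤ.* + (weight a C k)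
    ≡⟨ pascal-bit b (weight a) k ⟩
  + (weight (b ∷ a) C suc k) ∎
  where
  open ≡-Reasoning
  x = map bitℤ a

record Representable (n d : ℕ) (F : ℕ → ℕ) : Set where
  constructor representable
  field
    poly : Poly n
    degree : DegreeAtMost d poly
    eval-bits : (a : Vec Bool n) → eval poly (map bitℤ a) ≡ + F (weight a)

representable-weaken : d ≤ e → Representable n d f → Representable n e f
representable-weaken d≤e (representable P P≤d P≗F) = representable P (degree-weaken d≤e P≤d) P≗F

representable-constant : ∀ c → Representable n 0 (λ _ → c)
representable-constant c =
  representable (constant (+ c)) (constant-degree (+ c)) (λ a → eval-constant (map bitℤ a) (+ c))

representable-C : ∀ k → Representable n k (_C k)
representable-C {n} k = representable (elementary n k) (elementary-degree n k) (eval-elementary n k)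

representable-+ : Representable n d f → Representable n d g → Representable n d (λ w → f w + g w)
representable-+ (representable P P≤d P≗F) (representable Q Q≤d Q≗G) =
  representable (P ++ Q) (++⁺ P≤d Q≤d)
    (λ a → trans (eval-++ (map bitℤ a) P Q) (cong₂ ℤ._+_ (P≗F a) (Q≗G a)))

representable-* : Representable n d f → Representable n e g → Representable n (d + e) (λ w → f w * g w)
representable-* {f = f} {g = g} (representable P P≤d P≗F) (representable Q Q≤e Q≗G) =
  representable (P *ᴾ Q) (*ᴾ-degree P≤d Q≤e)
    (λ a → trans (eval-*ᴾ (map bitℤ a) P Q)
                 (trans (cong₂ ℤ._*_ (P≗F a) (Q≗G a)) (sym (ℤP.pos-* (f (weight a)) (g (weight a))))))

-- Binomial coefficients modulo a prime

module _ {p : ℕ} .{{_ : NonZero p}} {a b c d : ℕ} where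
  %-cong-+ : a % p ≡ b % p → c % p ≡ d % p → (a + c) % p ≡ (b + d) % p
  %-cong-+ a≡b c≡d = begin
    (a + c) % p           ≡⟨ %-distribˡ-+ a c p ⟩
    (a % p + c % p) % p   ≡⟨ cong₂ (λ u v → (u + v) % p) a≡b c≡d ⟩
    (b % p + d % p) % p   ≡⟨ %-distribˡ-+ b d p ⟨
    (b + d) % p           ∎
    where open ≡-Reasoning

  %-cong-* : a % p ≡ b % p → c % p ≡ d % p → (a * c) % p ≡ (b * d) % p
  %-cong-* a≡b c≡d = begin
    (a * c) % p           ≡⟨ %-distribˡ-* a c p ⟩
    (a % p * (c % p)) % p ≡⟨ cong₂ (λ u v → (u * v) % p) a≡b c≡d ⟩
    (b % p * (d % p)) % p ≡⟨ %-distribˡ-* b d p ⟨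
    (b * d) % p           ∎
    where open ≡-Reasoning

[1+k]*[1+n]Ck≡[1+n]*nCk : ∀ n k → suc k * (suc n C suc k) ≡ suc n * (n C k)
[1+k]*[1+n]Ck≡[1+n]*nCk zero zero = refl
[1+k]*[1+n]Ck≡[1+n]*nCk zero (suc k) = *-zeroʳ (suc (suc k))
[1+k]*[1+n]Ck≡[1+n]*nCk (suc n) zero =
  trans (*-identityˡ (suc (suc n) C 1)) (trans (nC1≡n (suc (suc n))) (sym (*-identityʳ (suc (suc n)))))
[1+k]*[1+n]Ck≡[1+n]*nCk (suc n) (suc k) = begin
  suc (suc k) * (suc (suc n) C suc (suc k))
    ≡⟨ cong (suc (suc k) *_) (pascal (suc n) (suc k)) ⟨
  suc (suc k) * (A + B)
    ≡⟨ distribute k A B ⟩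
  A + (suc k * A + suc (suc k) * B)
    ≡⟨ cong₂ (λ u v → A + (u + v)) ([1+k]*[1+n]Ck≡[1+n]*nCk n k) ([1+k]*[1+n]Ck≡[1+n]*nCk n (suc k)) ⟩
  A + (suc n * x + suc n * y)
    ≡⟨ cong (λ u → u + (suc n * x + suc n * y)) (pascal n k) ⟨
  (x + y) + (suc n * x + suc n * y)
    ≡⟨ collect n x y ⟩
  suc (suc n) * (x + y)
    ≡⟨ cong (suc (suc n) *_) (pascal n k) ⟩
  suc (suc n) * A ∎
  where
  open ≡-Reasoning
  pascal = nCk+nC[k+1]≡[n+1]C[k+1]
  x = n C k
  y = n C suc k
  A = suc n C suc k
  B = suc n C suc (suc k)
  distribute : ∀ k A B → suc (suc k) * (A + B) ≡ A + (suc k * A + suc (suc k) * B)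
  distribute = solve-∀
  collect : ∀ n x y → (x + y) + (suc n * x + suc n * y) ≡ suc (suc n) * (x + y)
  collect = solve-∀

n∣k*nCk : ∀ n k → n ∣ k * (n C k)
n∣k*nCk n zero = n ∣0
n∣k*nCk zero (suc k) = ∣-reflexive (sym (*-zeroʳ (suc k)))
n∣k*nCk (suc n) (suc k) = divides (n C k) (trans ([1+k]*[1+n]Ck≡[1+n]*nCk n k) (*-comm (suc n) (n C k)))

p^j∣k*c⇒p^j∣k : ∀ {p c} → Prime p → ¬ p ∣ c → ∀ j {k} → p ^ j ∣ k * c → p ^ j ∣ k
p^j∣k*c⇒p^j∣k p-prime p∤c zero _ = 1∣ _
p^j∣k*c⇒p^j∣k {p} {c} p-prime p∤c (suc j) {k} p^[1+j]∣kc
  with euclidsLemma k c p-prime (∣-trans (m∣m*n (p ^ j)) p^[1+j]∣kc)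
... | inj₂ p∣c = contradiction p∣c p∤c
... | inj₁ (divides k′ refl) =
  subst (p * p ^ j ∣_) (*-comm p k′) (*-monoʳ-∣ p (p^j∣k*c⇒p^j∣k p-prime p∤c j p^j∣k′c))
  where
  instance _ = prime⇒nonZero p-prime
  regroup : ∀ k′ p c → k′ * p * c ≡ p * (k′ * c)
  regroup = solve-∀
  p^j∣k′c : p ^ j ∣ k′ * c
  p^j∣k′c = *-cancelˡ-∣ p (subst (p * p ^ j ∣_) (regroup k′ p c) p^[1+j]∣kc)

p∣p^jCk : ∀ {p} → Prime p → ∀ j {k} → 0 < k → k < p ^ j → p ∣ p ^ j C k
p∣p^jCk {p} p-prime j {suc k} _ k<p^j with p ∣? p ^ j C suc k
... | yes p∣C = p∣C
... | no p∤C = contradiction (∣⇒≤ (p^j∣k*c⇒p^j∣k p-prime p∤C j (n∣k*nCk (p ^ j) (suc k)))) (<⇒≱ k<p^j)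

-- Row 1 + q of Pascal's triangle is 1 0 ⋯ 0 1 modulo p, so adding 1 + q to w fixes C(w, k) modulo p
-- for k ≤ q and increases C(w, 1 + q) by one.
module BinomialShift {p : ℕ} .{{_ : NonZero p}} {q : ℕ}
  (p∣[1+q]Ck : ∀ {k} → 0 < k → k < suc q → p ∣ suc q C k) where

  private
    pascal = nCk+nC[k+1]≡[n+1]C[k+1]

  [w+1+q]Ck≡wCk : ∀ w {k} → k < suc q → ((w + suc q) C k) % p ≡ (w C k) % p
  [w+1+q]Ck≡wCk w {zero} _ = refl
  [w+1+q]Ck≡wCk zero {suc k} k<1+q =
    trans (n∣m⇒m%n≡0 _ p (p∣[1+q]Ck z<s k<1+q)) (sym (n∣m⇒m%n≡0 0 p (p ∣0)))
  [w+1+q]Ck≡wCk (suc w) {suc k} k<1+q = begin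
    (suc (w + suc q) C suc k) % p
      ≡⟨ cong (_% p) (pascal (w + suc q) k) ⟨
    ((w + suc q) C k + (w + suc q) C suc k) % p
      ≡⟨ %-cong-+ ([w+1+q]Ck≡wCk w (<⇒≤ k<1+q)) ([w+1+q]Ck≡wCk w k<1+q) ⟩
    (w C k + w C suc k) % p
      ≡⟨ cong (_% p) (pascal w k) ⟩
    (suc w C suc k) % p ∎
    where open ≡-Reasoning

  [w+1+q]C[1+q]≡1+wC[1+q] : ∀ w → ((w + suc q) C suc q) % p ≡ suc (w C suc q) % p
  [w+1+q]C[1+q]≡1+wC[1+q] zero = cong (_% p) (nCn≡1 (suc q))
  [w+1+q]C[1+q]≡1+wC[1+q] (suc w) = begin
    (suc (w + suc q) C suc q) % p
      ≡⟨ cong (_% p) (pascal (w + suc q) q) ⟨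
    ((w + suc q) C q + (w + suc q) C suc q) % p
      ≡⟨ %-cong-+ ([w+1+q]Ck≡wCk w (n<1+n q)) ([w+1+q]C[1+q]≡1+wC[1+q] w) ⟩
    (w C q + suc (w C suc q)) % p
      ≡⟨ cong (_% p) (trans (+-suc (w C q) (w C suc q)) (cong suc (pascal w q))) ⟩
    suc (suc w C suc q) % p ∎
    where open ≡-Reasoning

  [m*[1+q]+r]C[1+q]≡m+rC[1+q] : ∀ m r → ((m * suc q + r) C suc q) % p ≡ (m + r C suc q) % p
  [m*[1+q]+r]C[1+q]≡m+rC[1+q] zero r = refl
  [m*[1+q]+r]C[1+q]≡m+rC[1+q] (suc m) r = begin
    ((suc m * suc q + r) C suc q) % p
      ≡⟨ cong (λ z → (z C suc q) % p) (rotate m (suc q) r) ⟩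
    ((m * suc q + r + suc q) C suc q) % p
      ≡⟨ [w+1+q]C[1+q]≡1+wC[1+q] (m * suc q + r) ⟩
    suc ((m * suc q + r) C suc q) % p
      ≡⟨ %-cong-+ {a = 1} refl ([m*[1+q]+r]C[1+q]≡m+rC[1+q] m r) ⟩
    (suc m + r C suc q) % p ∎
    where
    open ≡-Reasoning
    rotate : ∀ m Q r → suc m * Q + r ≡ m * Q + r + Q
    rotate = solve-∀

[wCq]%p≡w/q%p : ∀ {p} .{{_ : NonZero p}} q .{{_ : NonZero q}} →
  (∀ {k} → 0 < k → k < q → p ∣ q C k) → ∀ w → (w C q) % p ≡ w / q % p
[wCq]%p≡w/q%p {p} (suc q) p∣qCk w = begin
  (w C suc q) % p
    ≡⟨ cong (λ z → (z C suc q) % p) (trans (m≡m%n+[m/n]*n w (suc q)) (+-comm (w % suc q) _)) ⟩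
  ((w / suc q * suc q + w % suc q) C suc q) % p
    ≡⟨ [m*[1+q]+r]C[1+q]≡m+rC[1+q] (w / suc q) (w % suc q) ⟩
  (w / suc q + (w % suc q) C suc q) % p
    ≡⟨ cong (λ z → (w / suc q + z) % p) (k>n⇒nCk≡0 (m%n<n w (suc q))) ⟩
  (w / suc q + 0) % p
    ≡⟨ cong (_% p) (+-identityʳ (w / suc q)) ⟩
  w / suc q % p ∎
  where
  open ≡-Reasoning
  open BinomialShift p∣qCk

-- Comparing base-p digits

Indicator : (p : ℕ) .{{_ : NonZero p}} → ℕ → Set → Set
Indicator p m X = (m % p ≡ 1 × X) ⊎ (m % p ≡ 0 × ¬ X)

module _ {p : ℕ} .{{_ : NonZero p}} where

  %≡1⇒%≡1% : ∀ {m} → m % p ≡ 1 → m % p ≡ 1 % p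
  %≡1⇒%≡1% {m} m≡1 = trans (sym (m%n%n≡m%n m p)) (cong (_% p) m≡1)

  indicator-* : ∀ {m k} → Indicator p m X → Indicator p k Y → Indicator p (m * k) (X × Y)
  indicator-* (inj₁ (m≡1 , x)) (inj₁ (k≡1 , y)) =
    inj₁ (trans (%-cong-* (%≡1⇒%≡1% m≡1) (%≡1⇒%≡1% k≡1)) (trans (sym (%≡1⇒%≡1% m≡1)) m≡1) ,
          x , y)
  indicator-* {m = m} _ (inj₂ (k≡0 , ¬y)) =
    inj₂ (n∣m⇒m%n≡0 _ p (∣n⇒∣m*n m (m%n≡0⇒n∣m _ p k≡0)) , ¬y ∘ proj₂)
  indicator-* {k = k} (inj₂ (m≡0 , ¬x)) _ =
    inj₂ (n∣m⇒m%n≡0 _ p (∣m⇒∣m*n k (m%n≡0⇒n∣m _ p m≡0)) , ¬x ∘ proj₁)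

  indicator-⇔ : ∀ {m} → X ⇔ Y → Indicator p m X → Indicator p m Y
  indicator-⇔ X⇔Y (inj₁ (m≡1 , x)) = inj₁ (m≡1 , Equivalence.to X⇔Y x)
  indicator-⇔ X⇔Y (inj₂ (m≡0 , ¬x)) = inj₂ (m≡0 , ¬x ∘ Equivalence.from X⇔Y)

  indicator-% : ∀ {m k} → m % p ≡ k % p → Indicator p m X → Indicator p k X
  indicator-% m≡k (inj₁ (m≡1 , x)) = inj₁ (trans (sym m≡k) m≡1 , x)
  indicator-% m≡k (inj₂ (m≡0 , ¬x)) = inj₂ (trans (sym m≡k) m≡0 , ¬x)

  ∣+indicator⇔ : .{{_ : NonTrivial p}} → ∀ {c m} → p ∣ c + 1 → Indicator p m X → p ∣ c + m ⇔ X
  ∣+indicator⇔ {c = c} {m = m} p∣c+1 (inj₁ (m≡1 , x)) =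
    mk⇔ (λ _ → x) (λ _ → m%n≡0⇒n∣m (c + m) p c+m≡0)
    where
    c+m≡0 : (c + m) % p ≡ 0
    c+m≡0 = trans (%-cong-+ {a = c} refl (%≡1⇒%≡1% m≡1)) (n∣m⇒m%n≡0 (c + 1) p p∣c+1)
  ∣+indicator⇔ {c = c} {m = m} p∣c+1 (inj₂ (m≡0 , ¬x)) =
    mk⇔ (λ p∣c+m → contradiction (∣1⇒≡1 (p∣1 p∣c+m)) nonTrivial⇒≢1) (λ x → contradiction x ¬x)
    where
    p∣1 : p ∣ c + m → p ∣ 1
    p∣1 p∣c+m =
      ∣m+n∣m⇒∣n p∣c+1 (∣m+n∣m⇒∣n (subst (p ∣_) (+-comm c m) p∣c+m) (m%n≡0⇒n∣m m p m≡0))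

indicator-by-residues : ∀ {p} .{{_ : NonZero p}} (I : ℕ → ℕ → ℕ) →
  (∀ c c′ t t′ → c % p ≡ c′ % p → t % p ≡ t′ % p → I c t % p ≡ I c′ t′ % p) →
  (∀ {r u} → r < p → u < p → Indicator p (I r u) (r ≡ u)) →
  ∀ c t → Indicator p (I c t) (c % p ≡ t % p)
indicator-by-residues {p} I I-cong I-table c t =
  indicator-% (I-cong _ _ _ _ (m%n%n≡m%n c p) (m%n%n≡m%n t p)) (I-table (m%n<n c p) (m%n<n t p))

%[p*q]≡⇔%q≡×/q%p≡ : ∀ p q .{{_ : NonZero p}} .{{_ : NonZero q}} {{_ : NonZero (p * q)}} w T →
  w % (p * q) ≡ T % (p * q) ⇔ (w % q ≡ T % q × w / q % p ≡ T / q % p)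
%[p*q]≡⇔%q≡×/q%p≡ p q w T = mk⇔
  (λ e → trans (sym (%q-via-%[p*q] w)) (trans (cong (_% q) e) (%q-via-%[p*q] T)) ,
         trans (sym (m%[n*o]/o≡m/o%n w p q)) (trans (cong (_/ q) e) (m%[n*o]/o≡m/o%n T p q)))
  (λ (e , f) → trans (split w) (trans (cong₂ (λ u v → u + v * q) e f) (sym (split T))))
  where
  %q-via-%[p*q] : ∀ x → x % (p * q) % q ≡ x % q
  %q-via-%[p*q] x = m∣n⇒o%n%m≡o%m q (p * q) x (n∣m*n p)
  split : ∀ x → x % (p * q) ≡ x % q + x / q % p * q
  split x = trans (m≡m%n+[m/n]*n (x % (p * q)) q)
    (cong₂ (λ u v → u + v * q) (%q-via-%[p*q] x) (m%[n*o]/o≡m/o%n x p q))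

pred-+-pred-* : ∀ m k .{{_ : NonZero m}} .{{_ : NonZero k}} → pred m + pred k * m ≡ pred (k * m)
pred-+-pred-* (suc m) (suc k) = refl

module DigitTest {p : ℕ} .{{_ : NonZero p}} (p-prime : Prime p)
  (I : ℕ → ℕ → ℕ) (I-indicator : ∀ c t → Indicator p (I c t) (c % p ≡ t % p)) where

  infixl 7 _%p^_ _/p^_
  _%p^_ _/p^_ : ℕ → ℕ → ℕ
  w %p^ s = (w % p ^ s) {{m^n≢0 p s}}
  w /p^ s = (w / p ^ s) {{m^n≢0 p s}}

  [wCp^s]%p≡w/p^s%p : ∀ s w → (w C p ^ s) % p ≡ w /p^ s % p
  [wCp^s]%p≡w/p^s%p s = [wCq]%p≡w/q%p (p ^ s) {{m^n≢0 p s}} (p∣p^jCk p-prime s)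

  test : (T w s : ℕ) → ℕ
  test T w zero = 1
  test T w (suc s) = test T w s * I (w C p ^ s) (T /p^ s)

  test-indicator : ∀ T w s → Indicator p (test T w s) (w %p^ s ≡ T %p^ s)
  test-indicator T w zero =
    inj₁ (m<n⇒m%n≡m (nonTrivial⇒n>1 p {{prime⇒nonTrivial p-prime}}) , trans (n%1≡0 w) (sym (n%1≡0 T)))
  test-indicator T w (suc s) =
    indicator-⇔ (⇔-sym (%[p*q]≡⇔%q≡×/q%p≡ p (p ^ s) w T) ⇔-∘ (Identity.⇔-id _ ×-⇔ lucas))
      (indicator-* (test-indicator T w s) (I-indicator (w C p ^ s) (T /p^ s)))
    where
    instance _ = m^n≢0 p s
    instance _ = m^n≢0 p (suc s)
    lucas : (w C p ^ s) % p ≡ T /p^ s % p ⇔ w /p^ s % p ≡ T /p^ s % p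
    lucas = mk⇔ (trans (sym ([wCp^s]%p≡w/p^s%p s w))) (trans ([wCp^s]%p≡w/p^s%p s w))

  representable-test : ∀ {n} → (∀ q t → Representable n (pred p * q) (λ w → I (w C q) t)) →
    ∀ T s → Representable n (pred (p ^ s)) (λ w → test T w s)
  representable-test I-rep T zero = representable-constant 1
  representable-test I-rep T (suc s) =
    representable-weaken (≤-reflexive (pred-+-pred-* (p ^ s) p {{m^n≢0 p s}}))
      (representable-* (representable-test I-rep T s) (I-rep (p ^ s) (T /p^ s)))

-- I₂ and I₃ are 1 - (c - t)^(p-1) modulo p, as in Fermat's little theorem.
I₂ I₃ : ℕ → ℕ → ℕ
I₂ c t = c + t + 1
I₃ c t = 2 * ((c + 2 * t) * (c + 2 * t)) + 1

module _ {p : ℕ} .{{_ : NonZero p}} (c c′ t t′ : ℕ)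
  (c≡c′ : c % p ≡ c′ % p) (t≡t′ : t % p ≡ t′ % p) where
  I₂-cong : I₂ c t % p ≡ I₂ c′ t′ % p
  I₂-cong = %-cong-+ (%-cong-+ c≡c′ t≡t′) refl

  I₃-cong : I₃ c t % p ≡ I₃ c′ t′ % p
  I₃-cong = %-cong-+ (%-cong-* {a = 2} refl (%-cong-* x≡x′ x≡x′)) refl
    where x≡x′ = %-cong-+ c≡c′ (%-cong-* {a = 2} refl t≡t′)

I₂-indicator : ∀ c t → Indicator 2 (I₂ c t) (c % 2 ≡ t % 2)
I₂-indicator = indicator-by-residues I₂ (I₂-cong {p = 2}) table
  where
  table : ∀ {r u} → r < 2 → u < 2 → Indicator 2 (I₂ r u) (r ≡ u)
  table {0} {0} _ _ = inj₁ (refl , refl)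
  table {0} {1} _ _ = inj₂ (refl , λ ())
  table {1} {0} _ _ = inj₂ (refl , λ ())
  table {1} {1} _ _ = inj₁ (refl , refl)
  table {suc (suc _)} (s≤s (s≤s ()))
  table {_} {suc (suc _)} _ (s≤s (s≤s ()))

I₃-indicator : ∀ c t → Indicator 3 (I₃ c t) (c % 3 ≡ t % 3)
I₃-indicator = indicator-by-residues I₃ (I₃-cong {p = 3}) table
  where
  table : ∀ {r u} → r < 3 → u < 3 → Indicator 3 (I₃ r u) (r ≡ u)
  table {0} {0} _ _ = inj₁ (refl , refl)
  table {0} {1} _ _ = inj₂ (refl , λ ())
  table {0} {2} _ _ = inj₂ (refl , λ ())
  table {1} {0} _ _ = inj₂ (refl , λ ())
  table {1} {1} _ _ = inj₁ (refl , refl)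
  table {1} {2} _ _ = inj₂ (refl , λ ())
  table {2} {0} _ _ = inj₂ (refl , λ ())
  table {2} {1} _ _ = inj₂ (refl , λ ())
  table {2} {2} _ _ = inj₁ (refl , refl)
  table {suc (suc (suc _))} (s≤s (s≤s (s≤s ())))
  table {_} {suc (suc (suc _))} _ (s≤s (s≤s (s≤s ())))

module _ {n : ℕ} where

  representable-I₂ : ∀ q t → Representable n (1 * q) (λ w → I₂ (w C q) t)
  representable-I₂ q t = representable-weaken (≤-reflexive (sym (*-identityˡ q)))
    (representable-+ (representable-+ (representable-C q) (representable-weaken z≤n (representable-constant t)))
      (representable-weaken z≤n (representable-constant 1)))

  representable-I₃ : ∀ q t → Representable n (2 * q) (λ w → I₃ (w C q) t)
  representable-I₃ q t = representable-weaken (≤-reflexive (cong (λ m → q + m) (sym (+-identityʳ q))))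
    (representable-+ (representable-* (representable-constant 2) (representable-* x x))
      (representable-weaken z≤n (representable-constant 1)))
    where
    x : Representable n q (λ w → w C q + 2 * t)
    x = representable-+ (representable-C q) (representable-weaken z≤n (representable-constant (2 * t)))

%≡%⇒∣∸ : ∀ {A} .{{_ : NonZero A}} {w T} → w % A ≡ T % A → A ∣ w ∸ T
%≡%⇒∣∸ {A} {w} {T} w≡T = divides (w / A ∸ T / A) (begin
  w ∸ T                                     ≡⟨ cong₂ _∸_ (m≡m%n+[m/n]*n w A) (m≡m%n+[m/n]*n T A) ⟩
  (w % A + w / A * A) ∸ (T % A + T / A * A) ≡⟨ cong (λ r → (r + w / A * A) ∸ (T % A + T / A * A)) w≡T ⟩
  (T % A + w / A * A) ∸ (T % A + T / A * A) ≡⟨ [m+n]∸[m+o]≡n∸o (T % A) (w / A * A) (T / A * A) ⟩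
  w / A * A ∸ T / A * A                     ≡⟨ *-distribʳ-∸ A (w / A) (T / A) ⟨
  (w / A ∸ T / A) * A                       ∎)
  where open ≡-Reasoning

∣∧<⇒≡0 : ∀ {m n} .{{_ : NonZero m}} → m ∣ n → n < m → n ≡ 0
∣∧<⇒≡0 {m} {n} m∣n n<m = trans (sym (m<n⇒m%n≡m n<m)) (n∣m⇒m%n≡0 n m m∣n)

module _ {A B : ℕ} .{{_ : NonZero A}} .{{_ : NonZero B}} (B∣yA⇒B∣y : ∀ {y} → B ∣ y * A → B ∣ y) where

  private
    instance _ = m*n≢0 A B

    ≡-mod-*-≤ : ∀ {w T} → T ≤ w → w < A * B → w % A ≡ T % A → w % B ≡ T % B → w ≡ T
    ≡-mod-*-≤ {w} {T} T≤w w<AB w≡T[A] w≡T[B] with %≡%⇒∣∸ w≡T[A]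
    ... | divides y w∸T≡yA = ≤-antisym (m∸n≡0⇒m≤n w∸T≡0) T≤w
      where
      AB∣w∸T : A * B ∣ w ∸ T
      AB∣w∸T = subst (A * B ∣_) (trans (*-comm A y) (sym w∸T≡yA))
        (*-monoʳ-∣ A (B∣yA⇒B∣y (subst (B ∣_) w∸T≡yA (%≡%⇒∣∸ w≡T[B]))))
      w∸T≡0 : w ∸ T ≡ 0
      w∸T≡0 = ∣∧<⇒≡0 AB∣w∸T (≤-<-trans (m∸n≤m w T) w<AB)

  chinese-remainder : ∀ {w T} → w < A * B → T < A * B → (w % A ≡ T % A × w % B ≡ T % B) ⇔ w ≡ T
  chinese-remainder {w} {T} w<AB T<AB = mk⇔ to (λ { refl → refl , refl })
    where
    to : w % A ≡ T % A × w % B ≡ T % B → w ≡ T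
    to (w≡T[A] , w≡T[B]) with ≤-total T w
    ... | inj₁ T≤w = ≡-mod-*-≤ T≤w w<AB w≡T[A] w≡T[B]
    ... | inj₂ w≤T = sym (≡-mod-*-≤ w≤T T<AB (sym w≡T[A]) (sym w≡T[B]))

prime∤c⇒prime∤c^s : ∀ {p c} → Prime p → ¬ p ∣ c → ∀ s → ¬ p ∣ c ^ s
prime∤c⇒prime∤c^s p-prime p∤c zero p∣1 = nonTrivial⇒≢1 {{prime⇒nonTrivial p-prime}} (∣1⇒≡1 p∣1)
prime∤c⇒prime∤c^s {c = c} p-prime p∤c (suc s) p∣c^[1+s] with euclidsLemma c (c ^ s) p-prime p∣c^[1+s]
... | inj₁ p∣c = p∤c p∣c
... | inj₂ p∣c^s = prime∤c⇒prime∤c^s p-prime p∤c s p∣c^s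

∃-square-power : ∀ b .{{_ : NonTrivial b}} n → ∃[ s ] n < b ^ s * b ^ s × b ^ s * b ^ s ≤ 1 + b * b * n
∃-square-power b zero = 0 , z<s , s≤s z≤n
∃-square-power b (suc n) with ∃-square-power b n
... | s , n<x² , x²≤1+b²n with suc n <? b ^ s * b ^ s
...   | yes 1+n<x² = s , 1+n<x² , ≤-trans x²≤1+b²n (s≤s (*-monoʳ-≤ (b * b) (n≤1+n n)))
...   | no 1+n≮x² = suc s , subst (suc n <_) (sym [bx]²≡b²[1+n]) 1+n<b²[1+n] ,
      ≤-trans (≤-reflexive [bx]²≡b²[1+n]) (n≤1+n _)
  where
  instance _ = nonTrivial⇒nonZero b
  x = b ^ s
  [bx]²≡b²[1+n] : (b * x) * (b * x) ≡ b * b * suc n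
  [bx]²≡b²[1+n] = trans (square-* b x) (cong (b * b *_) (≤-antisym (≮⇒≥ 1+n≮x²) n<x²))
    where
    square-* : ∀ b x → (b * x) * (b * x) ≡ b * b * (x * x)
    square-* = solve-∀
  1+n<b²[1+n] : suc n < b * b * suc n
  1+n<b²[1+n] = subst (suc n <_) (*-comm (suc n) (b * b))
    (m<m*n (suc n) (b * b) (<-≤-trans (nonTrivial⇒n>1 b) (m≤m*n b b)))

pred-square≤ : ∀ x {m} → x * x ≤ suc m → pred x * pred x ≤ m
pred-square≤ zero _ = z≤n
pred-square≤ (suc y) [1+y]²≤1+m = s≤s⁻¹ (≤-trans 1+y²≤[1+y]² [1+y]²≤1+m)
  where
  1+y²≤[1+y]² : suc (y * y) ≤ suc y * suc y
  1+y²≤[1+y]² = s≤s (≤-trans (*-monoʳ-≤ y (n≤1+n y)) (m≤n+m (y * suc y) y))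

⊔-square≤ : ∀ x y {m} → x * x ≤ m → y * y ≤ m → (x ⊔ y) * (x ⊔ y) ≤ m
⊔-square≤ x y x²≤m y²≤m with ⊔-sel x y
... | inj₁ x⊔y≡x rewrite x⊔y≡x = x²≤m
... | inj₂ x⊔y≡y rewrite x⊔y≡y = y²≤m

<-square⇒<-* : ∀ x y {n} → n < x * x → n < y * y → n < x * y
<-square⇒<-* x y n<x² n<y² with ≤-total x y
... | inj₁ x≤y = ≤-trans n<x² (*-monoʳ-≤ x x≤y)
... | inj₂ y≤x = ≤-trans n<y² (*-monoˡ-≤ y y≤x)

weight≤length : ∀ {n} (a : Vec Bool n) → weight a ≤ n
weight≤length [] = z≤n
weight≤length (b ∷ a) = +-mono-≤ (bit≤1 b) (weight≤length a)
  where
  bit≤1 : ∀ b → bitℕ b ≤ 1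
  bit≤1 true = ≤-refl
  bit≤1 false = z≤n

6∣3x+2y⇔2∣x×3∣y : ∀ x y → 6 ∣ 3 * x + 2 * y ⇔ (2 ∣ x × 3 ∣ y)
6∣3x+2y⇔2∣x×3∣y x y = mk⇔
  (λ 6∣F → ∣m+n∣m⇒∣n (subst (2 ∣_) (split₂ x y) (∣-trans (divides 3 refl) 6∣F)) (m∣m*n (x + y)) ,
           ∣m+n∣m⇒∣n (subst (3 ∣_) (sym (split₃ x y)) (m∣m*n (x + y))) (∣-trans (divides 2 refl) 6∣F))
  (λ (2∣x , 3∣y) → ∣m∣n⇒∣m+n (*-monoʳ-∣ 3 2∣x) (*-monoʳ-∣ 2 3∣y))
  where
  split₂ : ∀ x y → 3 * x + 2 * y ≡ 2 * (x + y) + x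
  split₂ = solve-∀
  split₃ : ∀ x y → 3 * x + 2 * y + y ≡ 3 * (x + y)
  split₃ = solve-∀

prime[3] : Prime 3
prime[3] = from-yes (prime? 3)

module Mod6Test (T s t : ℕ) where

  module D₂ = DigitTest prime[2] I₂ I₂-indicator
  module D₃ = DigitTest prime[3] I₃ I₃-indicator

  F : ℕ → ℕ
  F w = 3 * (1 + D₂.test T w s) + 2 * (2 + D₃.test T w t)

  representable-F : ∀ {n} → Representable n (pred (2 ^ s) ⊔ pred (3 ^ t)) F
  representable-F = representable-+
    (representable-weaken (m≤m⊔n _ _) (representable-* (representable-constant 3)
      (representable-+ (representable-weaken z≤n (representable-constant 1))
                       (D₂.representable-test representable-I₂ T s))))
    (representable-weaken (m≤n⊔m _ _) (representable-* (representable-constant 2)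
      (representable-+ (representable-weaken z≤n (representable-constant 2))
                       (D₃.representable-test representable-I₃ T t))))

  6∣F⇔ : ∀ {w} → w < 2 ^ s * 3 ^ t → T < 2 ^ s * 3 ^ t → 6 ∣ F w ⇔ w ≡ T
  6∣F⇔ {w} w<2^s3^t T<2^s3^t = begin
    6 ∣ F w
      ≈⟨ 6∣3x+2y⇔2∣x×3∣y (1 + D₂.test T w s) (2 + D₃.test T w t) ⟩
    (2 ∣ 1 + D₂.test T w s × 3 ∣ 2 + D₃.test T w t)
      ≈⟨ ∣+indicator⇔ {c = 1} (divides 1 refl) (D₂.test-indicator T w s) ×-⇔
         ∣+indicator⇔ {c = 2} (divides 1 refl) (D₃.test-indicator T w t) ⟩
    (w D₂.%p^ s ≡ T D₂.%p^ s × w D₃.%p^ t ≡ T D₃.%p^ t)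
      ≈⟨ chinese-remainder {{m^n≢0 2 s}} {{m^n≢0 3 t}} 3^t∣y2^s⇒3^t∣y w<2^s3^t T<2^s3^t ⟩
    w ≡ T ∎
    where
    open SetoidReasoning (⇔-setoid 0ℓ)
    3^t∣y2^s⇒3^t∣y : ∀ {y} → 3 ^ t ∣ y * 2 ^ s → 3 ^ t ∣ y
    3^t∣y2^s⇒3^t∣y =
      p^j∣k*c⇒p^j∣k prime[3] (prime∤c⇒prime∤c^s prime[3] (λ 3∣2 → <⇒≱ ≤-refl (∣⇒≤ 3∣2)) s) t

theorem3p2 : (n T : ℕ) → T ≤ n →
    Σ (Poly n) λ P →
    Σ ℕ (λ d → (d * d ≤ 9 * n) × DegreeAtMost d P)
    × ((a : Vec Bool n) → ((+ 6) ℤ.∣ eval P (map bitℤ a)) ⇔ (weight a ≡ T))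
theorem3p2 n T T≤n with ∃-square-power 2 n | ∃-square-power 3 n
... | s , n<4^s , 4^s≤1+4n | t , n<9^t , 9^t≤1+9n =
  poly , (pred (2 ^ s) ⊔ pred (3 ^ t) , d²≤9n , degree) , 6∣P⇔weight≡T
  where
  open Mod6Test T s t
  open Representable (representable-F {n})
  d²≤9n : (pred (2 ^ s) ⊔ pred (3 ^ t)) * (pred (2 ^ s) ⊔ pred (3 ^ t)) ≤ 9 * n
  d²≤9n = ⊔-square≤ (pred (2 ^ s)) (pred (3 ^ t))
    (≤-trans (pred-square≤ (2 ^ s) 4^s≤1+4n) (*-monoˡ-≤ n (m≤m+n 4 5))) (pred-square≤ (3 ^ t) 9^t≤1+9n)
  n<2^s3^t : n < 2 ^ s * 3 ^ t
  n<2^s3^t = <-square⇒<-* (2 ^ s) (3 ^ t) n<4^s n<9^t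
  6∣P⇔weight≡T : (a : Vec Bool n) → (+ 6 ℤ.∣ eval poly (map bitℤ a)) ⇔ (weight a ≡ T)
  6∣P⇔weight≡T a = subst (λ z → (+ 6 ℤ.∣ z) ⇔ (weight a ≡ T)) (sym (eval-bits a))
    (6∣F⇔ (≤-<-trans (weight≤length a) n<2^s3^t) (≤-<-trans T≤n n<2^s3^t))
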